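{- Let $n\geqslant 6$ be an integer and $p,q$ primes with $pq\mid n$ and $\gcd(pq,n/(pq))=1$. Let $S$ be a square-free and periodic subset of $\mathbb{Z}_n$ with $|S|=pq$. Then the connected Cayley sum graph $\mathrm{CS}(\mathbb{Z}_n,S)$ admits a total perfect code if and only if $s\not\equiv s'\pmod{pq}$ for all distinct $s,s'\in S$.
   Context: For an abelian group $G$ and $S\subseteq G$, the Cayley sum graph $\mathrm{CS}(G,S)$ has vertex set $G$, two vertices $g,h$ adjacent iff $g+h\in S$ and $g\neq h$. A total perfect code of a graph is a set $C$ of vertices such that every vertex has exactly one neighbor in $C$. $S$ is square-free if it contains no element of the form $y+y$, $y\in G$. A nonempty $X\subseteq G$ is periodic if its stabilizer $G_X=\{g\in G: X+g=X\}$ is not $\{0\}$, and aperiodic otherwise. The hypothesis "connected" means the theorem concerns those $S$ for which $\mathrm{CS}(\mathbb{Z}_n,S)$ is connected. Elements of $\mathbb{Z}_n$ are identified with integers $0,\dots,n-1$. -}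

module Defs where

open import Data.Nat using (ℕ; zero; suc; _+_; ∣_-_∣)
open import Data.Nat.DivMod using (_mod_)
open import Data.Nat.Divisibility using (_∣_)
open import Data.Fin using (Fin; toℕ)
open import Data.Fin.Subset using (Subset; _∈_)
open import Data.Product using (Σ; ∃; ∃!; _×_; _,_)
open import Relation.Binary.PropositionalEquality using (_≡_; _≢_)
open import Relation.Binary.Construct.Closure.ReflexiveTransitive using (Star)
open import Relation.Nullary using (¬_)
open import Function.Bundles using (_⇔_)

_⊕_ : ∀ {n} → Fin n → Fin n → Fin n
_⊕_ {suc m} a b = (toℕ a + toℕ b) mod (suc m)

CSAdj : ∀ {n} → Subset n → Fin n → Fin n → Set
CSAdj S g h = (g ≢ h) × ((g ⊕ h) ∈ S)

Connected : ∀ {n} → Subset n → Set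
Connected {n} S = (g h : Fin n) → Star (CSAdj S) g h

IsTotalPerfectCode : ∀ {n} → Subset n → Subset n → Set
IsTotalPerfectCode {n} S C = (v : Fin n) → ∃! _≡_ (λ c → (c ∈ C) × CSAdj S v c)

HasTotalPerfectCode : ∀ {n} → Subset n → Set
HasTotalPerfectCode {n} S = Σ (Subset n) (IsTotalPerfectCode S)

SquareFree : ∀ {n} → Subset n → Set
SquareFree {n} S = ¬ (Σ (Fin n) λ y → (y ⊕ y) ∈ S)

_∈Translate_by_ : ∀ {n} → Fin n → Subset n → Fin n → Set
y ∈Translate X by g = ∃ λ x → (x ∈ X) × ((x ⊕ g) ≡ y)

InStabilizer : ∀ {n} → Subset n → Fin n → Set
InStabilizer {n} X g = (y : Fin n) → (y ∈Translate X by g) ⇔ (y ∈ X)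

Periodic : ∀ {n} → Subset n → Set
Periodic {n} X = Σ (Fin n) λ g → (toℕ g ≢ 0) × InStabilizer X g

_≡_[mod_] : ℕ → ℕ → ℕ → Set
a ≡ b [mod d ] = d ∣ ∣ a - b ∣

{-# OPTIONS --safe #-}
module Submission where

-- View subsets and multisets of ℤₙ as functions ℤₙ → ℕ, multiplied by convolution ⋆. For
-- square-free S, C is a total perfect code of CS(ℤₙ, S) iff every v has exactly one c ∈ C with
-- v + c ∈ S, i.e. iff 𝟙_S ⋆ 𝟙_{−C} = 1: S and −C tile ℤₙ. Tijdeman's dilation theorem says that
-- if f ⋆ h = 1 and t is coprime to the mass |f|, then the image of f under x ↦ t·x still tiles
-- with h. For t = p prime, the Frobenius congruence f^p ≡ (image of f under x ↦ p·x) (mod p)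
-- makes the dilated product ≡ f^(p-1) ⋆ (f ⋆ h) = |f|^(p-1) ≢ 0 (mod p) at every point; having
-- total mass n, it is constantly 1. A general t is a product of primes.
-- A multiset that tiles is a set, so for t = m = n/(pq), coprime to |S| = pq, the map s ↦ m·s is
-- injective on S; as m·s = m·s′ in ℤₙ iff s ≡ s′ (mod pq), the residues of S mod pq are
-- distinct. Conversely, pq distinct residues exhaust ℤ_{pq}, and then the multiples of pq form a
-- total perfect code.

open import Defs
open import Level using (0ℓ)
open import Algebra.Core using (Op₁; Op₂)
open import Algebra.Bundles using (AbelianGroup; CommutativeSemiring)
open import Algebra.Structures using (IsAbelianGroup)
open import Algebra.Structures.Biased using (isCommutativeSemiringˡ)
import Algebra.Construct.Pointwise as Pointwise
open import Data.Bool.Base using (Bool; true; false; if_then_else_)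
open import Data.Nat.Base
  using (ℕ; zero; suc; pred; _+_; _*_; _∸_; _^_; ∣_-_∣; _≤_; _<_; z≤n; s≤s; _!;
         NonZero; ≢-nonZero; >-nonZero⁻¹)
open import Data.Nat.Properties hiding (_≟_)
import Data.Nat.Properties as ℕ
open import Data.Nat.Divisibility
  using (_∣_; _∣?_; divides; ∣-trans; ∣-refl; ∣⇒≤; ∣1⇒≡1; m∣m*n; n∣m*n; ∣m⇒∣m*n; ∣m∣n⇒∣m+n; _∣0;
         m%n≡0⇒n∣m)
open import Data.Nat.DivMod
  using (_%_; _/_; _mod_; %-distribˡ-+; %-distribˡ-*; m%n%n≡m%n; m/n*n≡m; %-remove-+ˡ; %-remove-+ʳ;
         m≡m%n+[m/n]*n; m<n⇒m%n≡m; n%n≡0; %-congʳ; m%n*o≡m*o%[n*o]; m∣n⇒o%n%m≡o%m)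
open import Data.Nat.Primality using (Prime; euclidsLemma; ¬prime[1]; prime⇒nonZero)
open import Data.Nat.Primality.Factorisation using (PrimeFactorisation; factorise; factors)
open import Data.Nat.Coprimality using (Coprime)
import Data.Nat.Coprimality as Coprimality
open import Data.Nat.Combinatorics using (_C_; nCn≡1; nCk≡nC[n∸k]; k![n∸k]!∣n!)
open import Data.Nat.Combinatorics.Specification using (nCk≡n!/k![n-k]!)
open import Data.Nat.ListAction using (product)
open import Data.Fin.Base using (Fin; zero; suc; toℕ; fromℕ; inject₁; punchIn)
open import Data.Fin.Properties
  using (_≟_; toℕ-injective; toℕ-fromℕ<; toℕ-fromℕ; toℕ-inject₁; toℕ<n; punchInᵢ≢i; ¬∀⟶∃¬)
open import Data.Fin.Permutation using (Permutation; permutation)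
open import Data.Fin.Subset using (Subset; _∈_; ∣_∣)
open import Data.List.Base using ([]; _∷_)
open import Data.List.Relation.Unary.All using (All; []; _∷_)
open import Data.Vec.Base using ([]; _∷_; lookup; tabulate)
open import Data.Vec.Properties using ([]=⇒lookup; lookup⇒[]=; lookup∘tabulate)
open import Data.Product.Base using (∃; _×_; _,_; proj₁; proj₂)
open import Data.Sum.Base using (inj₁; inj₂; [_,_]′)
open import Function.Base using (_∘_; id; const)
open import Function.Bundles using (_⇔_; mk⇔; module Equivalence)
open import Relation.Nullary using (¬_; does; yes; no; contradiction)
open import Relation.Nullary.Decidable using (dec-true; dec-false; decidable-stable)
open import Relation.Binary.PropositionalEquality
open import Algebra.Properties.CommutativeSemigroup +-commutativeSemigroup using (x∙yz≈y∙xz)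
open import Algebra.Properties.Semiring.Sum +-*-semiring
  using (sum; sum-cong-≗; sum-remove; sum-replicate-zero; sum-init-last; sum-permute;
         ∑-comm; ∑-distrib-+; *-distribˡ-sum; *-distribʳ-sum)

private
  variable
    m n o p : ℕ

-- Indicators and finite sums

𝟙 : Bool → ℕ
𝟙 b = if b then 1 else 0

𝟙≤1 : ∀ b → 𝟙 b ≤ 1
𝟙≤1 true  = ≤-refl
𝟙≤1 false = z≤n

δ : Fin n → Fin n → ℕ
δ i j = 𝟙 (does (i ≟ j))

δ-refl : ∀ (i : Fin n) → δ i i ≡ 1
δ-refl i = cong 𝟙 (dec-true (i ≟ i) refl)

δ-≢ : ∀ {i j : Fin n} → i ≢ j → δ i j ≡ 0
δ-≢ {i = i} {j} i≢j = cong 𝟙 (dec-false (i ≟ j) i≢j)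

δ-sym : ∀ (i j : Fin n) → δ i j ≡ δ j i
δ-sym i j with i ≟ j
... | yes refl = sym (δ-refl i)
... | no i≢j   = sym (δ-≢ (i≢j ∘ sym))

δ≤1 : ∀ (i j : Fin n) → δ i j ≤ 1
δ≤1 i j = 𝟙≤1 (does (i ≟ j))

δ≢0⇒≡ : ∀ {i j : Fin n} → δ i j ≢ 0 → i ≡ j
δ≢0⇒≡ {i = i} {j} δ≢0 = decidable-stable (i ≟ j) (δ≢0 ∘ δ-≢)

δ-injective : ∀ {φ : Fin n → Fin m} → (∀ {i j} → φ i ≡ φ j → i ≡ j) →
              ∀ i j → δ (φ i) (φ j) ≡ δ i j
δ-injective {φ = φ} φ-injective i j with i ≟ j
... | yes refl = δ-refl (φ i)
... | no i≢j   = δ-≢ (i≢j ∘ φ-injective)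

*≢0⇒≢0ˡ : ∀ a b → a * b ≢ 0 → a ≢ 0
*≢0⇒≢0ˡ a b a*b≢0 refl = a*b≢0 refl

*≢0⇒≢0ʳ : ∀ a b → a * b ≢ 0 → b ≢ 0
*≢0⇒≢0ʳ a b a*b≢0 refl = a*b≢0 (*-zeroʳ a)

sum-single : ∀ (f : Fin n → ℕ) i → (∀ j → j ≢ i → f j ≡ 0) → sum f ≡ f i
sum-single {suc n} f i f≡0 = begin
  sum f                     ≡⟨ sum-remove {i = i} f ⟩
  f i + sum (f ∘ punchIn i) ≡⟨ cong (f i +_) (sum-cong-≗ (λ j → f≡0 _ (punchInᵢ≢i i j))) ⟩
  f i + sum {n} (const 0)   ≡⟨ cong (f i +_) (sum-replicate-zero n) ⟩
  f i + 0                   ≡⟨ +-identityʳ (f i) ⟩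
  f i                       ∎
  where open ≡-Reasoning

sum-δ-* : ∀ (i : Fin n) (f : Fin n → ℕ) → sum (λ j → δ i j * f j) ≡ f i
sum-δ-* i f = begin
  sum (λ j → δ i j * f j) ≡⟨ sum-single _ i (λ j j≢i → cong (_* f j) (δ-≢ (j≢i ∘ sym))) ⟩
  δ i i * f i             ≡⟨ cong (_* f i) (δ-refl i) ⟩
  1 * f i                 ≡⟨ *-identityˡ (f i) ⟩
  f i                     ∎
  where open ≡-Reasoning

sum-δ : ∀ (i : Fin n) → sum (δ i) ≡ 1
sum-δ i = trans (sum-single (δ i) i (λ j j≢i → δ-≢ (j≢i ∘ sym))) (δ-refl i)

sum-const-1 : ∀ n → sum {n} (const 1) ≡ n
sum-const-1 zero    = refl
sum-const-1 (suc n) = cong suc (sum-const-1 n)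

term≤sum : ∀ (f : Fin n → ℕ) i → f i ≤ sum f
term≤sum f zero    = m≤m+n _ _
term≤sum f (suc i) = ≤-trans (term≤sum (f ∘ suc) i) (m≤n+m _ _)

terms≤sum : ∀ (f : Fin n → ℕ) {i j} → i ≢ j → f i + f j ≤ sum f
terms≤sum f {zero}  {zero}  i≢j = contradiction refl i≢j
terms≤sum f {zero}  {suc j} _   = +-monoʳ-≤ (f zero) (term≤sum (f ∘ suc) j)
terms≤sum f {suc i} {zero}  _   =
  ≤-trans (≤-reflexive (+-comm (f (suc i)) (f zero))) (+-monoʳ-≤ (f zero) (term≤sum (f ∘ suc) i))
terms≤sum f {suc i} {suc j} i≢j = ≤-trans (terms≤sum (f ∘ suc) (i≢j ∘ cong suc)) (m≤n+m _ _)

sum≢0⇒∃≢0 : ∀ (f : Fin n → ℕ) → sum f ≢ 0 → ∃ λ i → f i ≢ 0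
sum≢0⇒∃≢0 {n} f sum≢0 = ¬∀⟶∃¬ n (λ i → f i ≡ 0) (λ i → f i ℕ.≟ 0)
  (λ f≡0 → sum≢0 (trans (sum-cong-≗ f≡0) (sum-replicate-zero n)))

sum≡0⇒≗0 : ∀ (f : Fin n → ℕ) → sum f ≡ 0 → f ≗ const 0
sum≡0⇒≗0 f sum≡0 i = n≤0⇒n≡0 (≤-trans (term≤sum f i) (≤-reflexive sum≡0))

sum-mono-≤ : ∀ {f g : Fin n → ℕ} → (∀ i → f i ≤ g i) → sum f ≤ sum g
sum-mono-≤ {zero}  f≤g = z≤n
sum-mono-≤ {suc n} f≤g = +-mono-≤ (f≤g zero) (sum-mono-≤ (f≤g ∘ suc))

≤∧sum≡⇒≗ : ∀ {f g : Fin n → ℕ} → (∀ i → f i ≤ g i) → sum f ≡ sum g → f ≗ g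
≤∧sum≡⇒≗ {suc n} {f} {g} f≤g sum≡ = λ where
    zero    → head≡
    (suc i) → ≤∧sum≡⇒≗ (f≤g ∘ suc) tail≡ i
  where
  head≡ : f zero ≡ g zero
  head≡ = ≤-antisym (f≤g zero) (+-cancelʳ-≤ (sum (g ∘ suc)) (g zero) (f zero)
    (≤-trans (≤-reflexive (sym sum≡)) (+-monoʳ-≤ (f zero) (sum-mono-≤ (f≤g ∘ suc)))))
  tail≡ : sum (f ∘ suc) ≡ sum (g ∘ suc)
  tail≡ = +-cancelˡ-≡ (f zero) _ _ (trans sum≡ (cong (_+ sum (g ∘ suc)) (sym head≡)))

sum≤1 : ∀ {f : Fin n → ℕ} → (∀ i → f i ≤ 1) → (∀ i j → f i ≢ 0 → f j ≢ 0 → i ≡ j) →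
        sum f ≤ 1
sum≤1 {f = f} f≤1 f-unique with sum f ℕ.≟ 0
... | yes sum≡0 = ≤-trans (≤-reflexive sum≡0) z≤n
... | no sum≢0 with sum≢0⇒∃≢0 f sum≢0
...   | i , fᵢ≢0 = ≤-trans (≤-reflexive (sum-single f i f≡0)) (f≤1 i)
  where
  f≡0 : ∀ j → j ≢ i → f j ≡ 0
  f≡0 j j≢i = decidable-stable (f j ℕ.≟ 0) (λ fⱼ≢0 → j≢i (f-unique j i fⱼ≢0 fᵢ≢0))

𝟙[_] : Subset n → Fin n → ℕ
𝟙[ S ] x = 𝟙 (lookup S x)

sum-𝟙[] : ∀ (S : Subset n) → sum 𝟙[ S ] ≡ ∣ S ∣
sum-𝟙[] []          = refl
sum-𝟙[] (true ∷ S)  = cong suc (sum-𝟙[] S)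
sum-𝟙[] (false ∷ S) = sum-𝟙[] S

𝟙[]≤1 : ∀ (S : Subset n) x → 𝟙[ S ] x ≤ 1
𝟙[]≤1 S x = 𝟙≤1 (lookup S x)

∈⇒𝟙[]≡1 : ∀ {S : Subset n} {x} → x ∈ S → 𝟙[ S ] x ≡ 1
∈⇒𝟙[]≡1 x∈S = cong 𝟙 ([]=⇒lookup x∈S)

𝟙[]≢0⇒∈ : ∀ (S : Subset n) x → 𝟙[ S ] x ≢ 0 → x ∈ S
𝟙[]≢0⇒∈ S x with lookup S x in eq
... | true  = λ _ → lookup⇒[]= x S eq
... | false = λ 0≢0 → contradiction refl 0≢0

𝟙[]*𝟙[]≡0 : ∀ (S : Subset n) (T : Subset m) x y → ¬ (x ∈ S × y ∈ T) →
            𝟙[ S ] x * 𝟙[ T ] y ≡ 0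
𝟙[]*𝟙[]≡0 S T x y ∉ with lookup S x in x∈S | lookup T y in y∈T
... | true  | true  = contradiction (lookup⇒[]= x S x∈S , lookup⇒[]= y T y∈T) ∉
... | true  | false = refl
... | false | _     = refl

infixl 6 _⊞_
_⊞_ : (Fin n → ℕ) → (Fin n → ℕ) → Fin n → ℕ
(f ⊞ g) x = f x + g x

δ-split : ∀ (f : Fin n → ℕ) y → f y ≢ 0 → f ≗ δ y ⊞ (λ z → f z ∸ δ y z)
δ-split f y fy≢0 z = sym (m+[n∸m]≡n δ≤f)
  where
  δ≤f : δ y z ≤ f z
  δ≤f with y ≟ z
  ... | yes refl = n≢0⇒n>0 fy≢0
  ... | no _     = z≤n

-- Pushforward of multisets

push : (Fin n → Fin m) → (Fin n → ℕ) → Fin m → ℕ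
push φ f x = sum (λ y → f y * δ (φ y) x)

sum-push : ∀ (φ : Fin n → Fin m) f → sum (push φ f) ≡ sum f
sum-push φ f = begin
  sum (λ x → sum (λ y → f y * δ (φ y) x))  ≡⟨ ∑-comm (λ x y → f y * δ (φ y) x) ⟩
  sum (λ y → sum (λ x → f y * δ (φ y) x))  ≡⟨ sum-cong-≗ (λ y → *-distribˡ-sum (f y) (δ (φ y))) ⟨
  sum (λ y → f y * sum (δ (φ y)))          ≡⟨ sum-cong-≗ (λ y → cong (f y *_) (sum-δ (φ y))) ⟩
  sum (λ y → f y * 1)                      ≡⟨ sum-cong-≗ (λ y → *-identityʳ (f y)) ⟩
  sum f                                    ∎
  where open ≡-Reasoning

push-id : ∀ (f : Fin n → ℕ) → push id f ≗ f
push-id f x = begin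
  sum (λ y → f y * δ y x)
    ≡⟨ sum-cong-≗ (λ y → trans (*-comm (f y) (δ y x)) (cong (_* f y) (δ-sym y x))) ⟩
  sum (λ y → δ x y * f y)
    ≡⟨ sum-δ-* x f ⟩
  f x
    ∎
  where open ≡-Reasoning

push-∘ : ∀ (φ : Fin m → Fin o) (ψ : Fin n → Fin m) f → push φ (push ψ f) ≗ push (φ ∘ ψ) f
push-∘ φ ψ f x = begin
  sum (λ y → sum (λ z → f z * δ (ψ z) y) * δ (φ y) x)
    ≡⟨ sum-cong-≗ (λ y → *-distribʳ-sum (δ (φ y) x) (λ z → f z * δ (ψ z) y)) ⟩
  sum (λ y → sum (λ z → f z * δ (ψ z) y * δ (φ y) x))
    ≡⟨ ∑-comm (λ y z → f z * δ (ψ z) y * δ (φ y) x) ⟩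
  sum (λ z → sum (λ y → f z * δ (ψ z) y * δ (φ y) x))
    ≡⟨ sum-cong-≗ (λ z → sum-cong-≗ (λ y → *-assoc (f z) (δ (ψ z) y) (δ (φ y) x))) ⟩
  sum (λ z → sum (λ y → f z * (δ (ψ z) y * δ (φ y) x)))
    ≡⟨ sum-cong-≗ (λ z → *-distribˡ-sum (f z) (λ y → δ (ψ z) y * δ (φ y) x)) ⟨
  sum (λ z → f z * sum (λ y → δ (ψ z) y * δ (φ y) x))
    ≡⟨ sum-cong-≗ (λ z → cong (f z *_) (sum-δ-* (ψ z) (λ y → δ (φ y) x))) ⟩
  sum (λ z → f z * δ (φ (ψ z)) x)
    ∎
  where open ≡-Reasoning

push-δ : ∀ (φ : Fin n → Fin m) a → push φ (δ a) ≗ δ (φ a)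
push-δ φ a x = sum-δ-* a (λ y → δ (φ y) x)

push-⊞ : ∀ (φ : Fin n → Fin m) f g → push φ (f ⊞ g) ≗ push φ f ⊞ push φ g
push-⊞ φ f g x = trans (sum-cong-≗ (λ y → *-distribʳ-+ (δ (φ y) x) (f y) (g y)))
  (∑-distrib-+ (λ y → f y * δ (φ y) x) (λ y → g y * δ (φ y) x))

push-congˡ : ∀ (φ : Fin n → Fin m) {f g} → f ≗ g → push φ f ≗ push φ g
push-congˡ φ f≗g x = sum-cong-≗ (λ y → cong (_* δ (φ y) x) (f≗g y))

push-congʳ : ∀ (f : Fin n → ℕ) {φ ψ : Fin n → Fin m} → φ ≗ ψ → push φ f ≗ push ψ f
push-congʳ f φ≗ψ x = sum-cong-≗ (λ y → cong (λ z → f y * δ z x) (φ≗ψ y))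

push≢0⇒∃ : ∀ (φ : Fin n → Fin m) f {x} → push φ f x ≢ 0 → ∃ λ i → f i ≢ 0 × φ i ≡ x
push≢0⇒∃ φ f {x} push≢0 with sum≢0⇒∃≢0 (λ i → f i * δ (φ i) x) push≢0
... | i , term≢0 = i , *≢0⇒≢0ˡ _ _ term≢0 , δ≢0⇒≡ (*≢0⇒≢0ʳ (f i) _ term≢0)

push≤1 : ∀ (φ : Fin n → Fin m) f → (∀ i → f i ≤ 1) →
         (∀ i j → f i ≢ 0 → f j ≢ 0 → φ i ≡ φ j → i ≡ j) → ∀ x → push φ f x ≤ 1
push≤1 φ f f≤1 φ-injective x = sum≤1 (λ i → *-mono-≤ (f≤1 i) (δ≤1 (φ i) x)) unique
  where
  unique : ∀ i j → f i * δ (φ i) x ≢ 0 → f j * δ (φ j) x ≢ 0 → i ≡ j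
  unique i j tᵢ≢0 tⱼ≢0 = φ-injective i j (*≢0⇒≢0ˡ _ _ tᵢ≢0) (*≢0⇒≢0ˡ _ _ tⱼ≢0)
    (trans (δ≢0⇒≡ (*≢0⇒≢0ʳ (f i) _ tᵢ≢0)) (sym (δ≢0⇒≡ (*≢0⇒≢0ʳ (f j) _ tⱼ≢0))))

push-collision : ∀ (φ : Fin n → Fin m) f {i j} → i ≢ j → φ i ≡ φ j → f i + f j ≤ push φ f (φ i)
push-collision φ f {i} {j} i≢j φi≡φj = begin
  f i + f j                                  ≡⟨ cong₂ _+_ (*-identityʳ (f i)) (*-identityʳ (f j)) ⟨
  f i * 1 + f j * 1                          ≡⟨ cong₂ (λ u v → f i * u + f j * v) (δ-refl (φ i)) δⱼᵢ≡1 ⟨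
  f i * δ (φ i) (φ i) + f j * δ (φ j) (φ i)  ≤⟨ terms≤sum (λ y → f y * δ (φ y) (φ i)) i≢j ⟩
  push φ f (φ i)                             ∎
  where
  open ≤-Reasoning
  δⱼᵢ≡1 : δ (φ j) (φ i) ≡ 1
  δⱼᵢ≡1 = trans (cong (λ z → δ z (φ i)) (sym φi≡φj)) (δ-refl (φ i))

-- Divisibility and congruences

prime∤1 : Prime p → ¬ p ∣ 1
prime∤1 pr p∣1 = ¬prime[1] (subst Prime (∣1⇒≡1 p∣1) pr)

prime∤* : ∀ {a b} → Prime p → ¬ p ∣ a → ¬ p ∣ b → ¬ p ∣ a * b
prime∤* pr p∤a p∤b p∣ab = [ p∤a , p∤b ]′ (euclidsLemma _ _ pr p∣ab)

prime∤^ : ∀ {a} → Prime p → ¬ p ∣ a → ∀ j → ¬ p ∣ a ^ j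
prime∤^ pr p∤a zero    = prime∤1 pr
prime∤^ pr p∤a (suc j) = prime∤* pr p∤a (prime∤^ pr p∤a j)

prime∤! : ∀ {j} → Prime p → j < p → ¬ p ∣ j !
prime∤! {j = zero}  pr _   = prime∤1 pr
prime∤! {j = suc j} pr j<p =
  prime∤* pr (λ p∣j → <⇒≱ j<p (∣⇒≤ p∣j)) (prime∤! pr (<-trans (n<1+n j) j<p))

prime∣C : ∀ {j} → Prime p → 0 < j → j < p → p ∣ p C j
prime∣C {p@(suc p′)} {j} pr 0<j j<p =
  [ id , (λ p∣j!*[p∸j]! → contradiction p∣j!*[p∸j]! (prime∤* pr (prime∤! pr j<p) (prime∤! pr p∸j<p))) ]′
    (euclidsLemma _ _ pr (subst (p ∣_) (sym C*j!*[p∸j]!≡p!) (m∣m*n (p′ !))))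
  where
  instance _ = j !* (p ∸ j) !≢0
  p∸j<p : p ∸ j < p
  p∸j<p = ∸-monoʳ-< 0<j (<⇒≤ j<p)
  C*j!*[p∸j]!≡p! : (p C j) * (j ! * (p ∸ j) !) ≡ p !
  C*j!*[p∸j]!≡p! = trans (cong (_* (j ! * (p ∸ j) !)) (nCk≡n!/k![n-k]! (<⇒≤ j<p)))
                         (m/n*n≡m (k![n∸k]!∣n! (<⇒≤ j<p)))

coprime-∣ : ∀ {d m a} → d ∣ m → Coprime m a → Coprime d a
coprime-∣ d∣m coprime (i∣d , i∣a) = coprime (∣-trans i∣d d∣m , i∣a)

prime∧coprime⇒∤ : ∀ {a} → Prime p → Coprime p a → ¬ p ∣ a
prime∧coprime⇒∤ pr coprime p∣a = ¬prime[1] (subst Prime (coprime (∣-refl , p∣a)) pr)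

∣-sum : ∀ {d} (f : Fin n → ℕ) → (∀ i → d ∣ f i) → d ∣ sum f
∣-sum {zero}  f d∣f = _ ∣0
∣-sum {suc n} f d∣f = ∣m∣n⇒∣m+n (d∣f zero) (∣-sum (f ∘ suc) (d∣f ∘ suc))

binomial-sum-%-prime : .{{_ : NonZero p}} → Prime p → (a : Fin (suc p) → ℕ) →
                       sum (λ i → (p C toℕ i) * a i) % p ≡ (a zero + a (fromℕ p)) % p
binomial-sum-%-prime {p@(suc p′)} pr a = begin
  sum t % p                         ≡⟨ cong (λ s → (t zero + s) % p) (sum-init-last (t ∘ suc)) ⟩
  (t zero + (middle + t last)) % p  ≡⟨ cong (_% p) (x∙yz≈y∙xz (t zero) middle (t last)) ⟩
  (middle + (t zero + t last)) % p  ≡⟨ %-remove-+ˡ _ (∣-sum _ p∣middle) ⟩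
  (t zero + t last) % p             ≡⟨ cong₂ (λ x y → (x + y) % p) t₀≡a₀ tₚ≡aₚ ⟩
  (a zero + a (fromℕ p)) % p        ∎
  where
  open ≡-Reasoning
  t : Fin (suc p) → ℕ
  t i = (p C toℕ i) * a i
  last = suc (fromℕ p′)
  middle = sum (t ∘ suc ∘ inject₁)
  p∣middle : ∀ i → p ∣ t (suc (inject₁ i))
  p∣middle i = ∣m⇒∣m*n _ (prime∣C pr (s≤s z≤n) (s≤s (subst (_< p′) (sym (toℕ-inject₁ i)) (toℕ<n i))))
  t₀≡a₀ : t zero ≡ a zero
  t₀≡a₀ = trans (cong (_* a zero) (trans (nCk≡nC[n∸k] {0} {p} z≤n) (nCn≡1 p))) (*-identityˡ _)
  tₚ≡aₚ : t last ≡ a (fromℕ p)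
  tₚ≡aₚ = trans (cong (λ k → (p C suc k) * a last) (toℕ-fromℕ p′))
                (trans (cong (_* a last) (nCn≡1 p)) (*-identityˡ _))

[m%d+n]%d≡[m+n]%d : ∀ m n d .{{_ : NonZero d}} → (m % d + n) % d ≡ (m + n) % d
[m%d+n]%d≡[m+n]%d m n d = begin
  (m % d + n) % d           ≡⟨ %-distribˡ-+ (m % d) n d ⟩
  (m % d % d + n % d) % d   ≡⟨ cong (λ x → (x + n % d) % d) (m%n%n≡m%n m d) ⟩
  (m % d + n % d) % d       ≡⟨ %-distribˡ-+ m n d ⟨
  (m + n) % d               ∎
  where open ≡-Reasoning

[m+n%d]%d≡[m+n]%d : ∀ m n d .{{_ : NonZero d}} → (m + n % d) % d ≡ (m + n) % d
[m+n%d]%d≡[m+n]%d m n d = begin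
  (m + n % d) % d   ≡⟨ cong (_% d) (+-comm m (n % d)) ⟩
  (n % d + m) % d   ≡⟨ [m%d+n]%d≡[m+n]%d n m d ⟩
  (n + m) % d       ≡⟨ cong (_% d) (+-comm n m) ⟩
  (m + n) % d       ∎
  where open ≡-Reasoning

module _ {d : ℕ} .{{_ : NonZero d}} where

  %-+-congˡ : ∀ {a b} c → a % d ≡ b % d → (a + c) % d ≡ (b + c) % d
  %-+-congˡ {a} {b} c eq = begin
    (a + c) % d           ≡⟨ %-distribˡ-+ a c d ⟩
    (a % d + c % d) % d   ≡⟨ cong (λ x → (x + c % d) % d) eq ⟩
    (b % d + c % d) % d   ≡⟨ %-distribˡ-+ b c d ⟨
    (b + c) % d           ∎
    where open ≡-Reasoning

  %-*-congʳ : ∀ {a b} c → a % d ≡ b % d → (a * c) % d ≡ (b * c) % d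
  %-*-congʳ {a} {b} c eq = begin
    (a * c) % d             ≡⟨ %-distribˡ-* a c d ⟩
    (a % d * (c % d)) % d   ≡⟨ cong (λ x → (x * (c % d)) % d) eq ⟩
    (b % d * (c % d)) % d   ≡⟨ %-distribˡ-* b c d ⟨
    (b * c) % d             ∎
    where open ≡-Reasoning

  %-sum-cong : ∀ (f g : Fin n → ℕ) → (∀ i → f i % d ≡ g i % d) → sum f % d ≡ sum g % d
  %-sum-cong {zero}  f g f≡g = refl
  %-sum-cong {suc n} f g f≡g = begin
    (f zero + sum (f ∘ suc)) % d  ≡⟨ %-+-congˡ _ (f≡g zero) ⟩
    (g zero + sum (f ∘ suc)) % d  ≡⟨ cong (_% d) (+-comm (g zero) _) ⟩
    (sum (f ∘ suc) + g zero) % d  ≡⟨ %-+-congˡ _ (%-sum-cong (f ∘ suc) (g ∘ suc) (f≡g ∘ suc)) ⟩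
    (sum (g ∘ suc) + g zero) % d  ≡⟨ cong (_% d) (+-comm _ (g zero)) ⟩
    (g zero + sum (g ∘ suc)) % d  ∎
    where open ≡-Reasoning

  %≡%⇒≡[mod] : ∀ a b → a % d ≡ b % d → a ≡ b [mod d ]
  %≡%⇒≡[mod] a b eq = divides ∣ a / d - b / d ∣ (begin
    ∣ a - b ∣                                  ≡⟨ cong₂ ∣_-_∣ (m≡m%n+[m/n]*n a d) (m≡m%n+[m/n]*n b d) ⟩
    ∣ a % d + a / d * d - b % d + b / d * d ∣  ≡⟨ cong (λ r → ∣ r + a / d * d - b % d + b / d * d ∣) eq ⟩
    ∣ b % d + a / d * d - b % d + b / d * d ∣  ≡⟨ ∣m+n-m+o∣≡∣n-o∣ (b % d) _ _ ⟩
    ∣ a / d * d - b / d * d ∣                  ≡⟨ *-distribʳ-∣-∣ d (a / d) (b / d) ⟨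
    ∣ a / d - b / d ∣ * d                      ∎)
    where open ≡-Reasoning

  private
    ≤∧≡[mod]⇒%≡% : ∀ {a b} → b ≤ a → a ≡ b [mod d ] → a % d ≡ b % d
    ≤∧≡[mod]⇒%≡% {a} {b} b≤a d∣∣a-b∣ = begin
      a % d               ≡⟨ cong (_% d) (m+[n∸m]≡n b≤a) ⟨
      (b + (a ∸ b)) % d   ≡⟨ %-remove-+ʳ b (subst (d ∣_) (m≤n⇒∣n-m∣≡n∸m b≤a) d∣∣a-b∣) ⟩
      b % d               ∎
      where open ≡-Reasoning

  ≡[mod]⇒%≡% : ∀ a b → a ≡ b [mod d ] → a % d ≡ b % d
  ≡[mod]⇒%≡% a b d∣∣a-b∣ with ≤-total b a
  ... | inj₁ b≤a = ≤∧≡[mod]⇒%≡% b≤a d∣∣a-b∣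
  ... | inj₂ a≤b = sym (≤∧≡[mod]⇒%≡% a≤b (subst (d ∣_) (∣-∣-comm a b) d∣∣a-b∣))

module Convolution {n : ℕ} {op : Op₂ (Fin n)} {e : Fin n} {inv : Op₁ (Fin n)}
                   (isAbelianGroup : IsAbelianGroup _≡_ op e inv) where

  abelianGroup : AbelianGroup 0ℓ 0ℓ
  abelianGroup = record { isAbelianGroup = isAbelianGroup }

  open AbelianGroup abelianGroup using (_∙_; ε; _⁻¹; _-_; comm; assoc; identityʳ; monoid)
  open import Algebra.Properties.AbelianGroup abelianGroup
    using (//-rightDividesˡ; //-rightDividesʳ; ∙-cancelʳ; ⁻¹-anti-homo‿-; xyx⁻¹≈y; ⁻¹-∙-comm; ε⁻¹≈ε)
  open import Algebra.Properties.Monoid.Mult monoid using (×-homo-1; ×-assocˡ) renaming (_×_ to _·_)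

  x-[x-y]≡y : ∀ x y → x - (x - y) ≡ y
  x-[x-y]≡y x y = begin
    x ∙ (x - y) ⁻¹   ≡⟨ cong (x ∙_) (⁻¹-anti-homo‿- x y) ⟩
    x ∙ (y - x)      ≡⟨ assoc x y (x ⁻¹) ⟨
    x ∙ y ∙ x ⁻¹     ≡⟨ xyx⁻¹≈y x y ⟩
    y                ∎
    where open ≡-Reasoning

  x-[y∙z]≡x-z-y : ∀ x y z → x - (y ∙ z) ≡ x - z - y
  x-[y∙z]≡x-z-y x y z = begin
    x ∙ (y ∙ z) ⁻¹       ≡⟨ cong (x ∙_) (⁻¹-∙-comm y z) ⟨
    x ∙ (y ⁻¹ ∙ z ⁻¹)    ≡⟨ cong (x ∙_) (comm (y ⁻¹) (z ⁻¹)) ⟩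
    x ∙ (z ⁻¹ ∙ y ⁻¹)    ≡⟨ assoc x (z ⁻¹) (y ⁻¹) ⟨
    x - z - y            ∎
    where open ≡-Reasoning

  x-ε≡x : ∀ x → x - ε ≡ x
  x-ε≡x x = trans (cong (x ∙_) ε⁻¹≈ε) (identityʳ x)

  translation : Fin n → Permutation n n
  translation a = permutation (_∙ a) (_- a) (//-rightDividesˡ a) (//-rightDividesʳ a)

  reflection : Fin n → Permutation n n
  reflection x = permutation (x -_) (x -_) (x-[x-y]≡y x) (x-[x-y]≡y x)

  sum-translate : ∀ (f : Fin n → ℕ) a → sum (λ x → f (x - a)) ≡ sum f
  sum-translate f a = trans (sum-permute _ (translation a)) (sum-cong-≗ (cong f ∘ //-rightDividesʳ a))

  infixl 7 _⋆_
  _⋆_ : (Fin n → ℕ) → (Fin n → ℕ) → Fin n → ℕ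
  (f ⋆ g) x = sum (λ y → f y * g (x - y))

  ⋆-∘⁻¹ : ∀ f g x → (f ⋆ (g ∘ _⁻¹)) x ≡ sum (λ c → f (c ∙ x) * g c)
  ⋆-∘⁻¹ f g x = begin
    sum (λ y → f y * g ((x - y) ⁻¹))
      ≡⟨ sum-cong-≗ (λ y → cong (λ z → f y * g z) (⁻¹-anti-homo‿- x y)) ⟩
    sum (λ y → f y * g (y - x))
      ≡⟨ sum-permute _ (translation x) ⟩
    sum (λ c → f (c ∙ x) * g ((c ∙ x) - x))
      ≡⟨ sum-cong-≗ (λ c → cong (λ z → f (c ∙ x) * g z) (//-rightDividesʳ x c)) ⟩
    sum (λ c → f (c ∙ x) * g c)
      ∎
    where open ≡-Reasoning

  ⋆-comm : ∀ f g → f ⋆ g ≗ g ⋆ f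
  ⋆-comm f g x = begin
    sum (λ y → f y * g (x - y))
      ≡⟨ sum-permute _ (reflection x) ⟩
    sum (λ y → f (x - y) * g (x - (x - y)))
      ≡⟨ sum-cong-≗ (λ y → cong (λ z → f (x - y) * g z) (x-[x-y]≡y x y)) ⟩
    sum (λ y → f (x - y) * g y)
      ≡⟨ sum-cong-≗ (λ y → *-comm (f (x - y)) (g y)) ⟩
    sum (λ y → g y * f (x - y))
      ∎
    where open ≡-Reasoning

  ⋆-assoc : ∀ f g h → (f ⋆ g) ⋆ h ≗ f ⋆ (g ⋆ h)
  ⋆-assoc f g h x = begin
    sum (λ y → sum (λ z → f z * g (y - z)) * h (x - y))
      ≡⟨ sum-cong-≗ (λ y → *-distribʳ-sum (h (x - y)) (λ z → f z * g (y - z))) ⟩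
    sum (λ y → sum (λ z → f z * g (y - z) * h (x - y)))
      ≡⟨ ∑-comm (λ y z → f z * g (y - z) * h (x - y)) ⟩
    sum (λ z → sum (λ y → f z * g (y - z) * h (x - y)))
      ≡⟨ sum-cong-≗ (λ z → sum-cong-≗ (λ y → *-assoc (f z) (g (y - z)) (h (x - y)))) ⟩
    sum (λ z → sum (λ y → f z * (g (y - z) * h (x - y))))
      ≡⟨ sum-cong-≗ (λ z → *-distribˡ-sum (f z) (λ y → g (y - z) * h (x - y))) ⟨
    sum (λ z → f z * sum (λ y → g (y - z) * h (x - y)))
      ≡⟨ sum-cong-≗ (λ z → cong (f z *_) (translate z)) ⟩
    sum (λ z → f z * sum (λ w → g w * h (x - z - w)))
      ∎
    where
    open ≡-Reasoning
    translate : ∀ z → sum (λ y → g (y - z) * h (x - y)) ≡ sum (λ w → g w * h (x - z - w))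
    translate z = trans (sum-permute _ (translation z))
      (sum-cong-≗ (λ w → cong₂ (λ u v → g u * h v) (//-rightDividesʳ z w) (x-[y∙z]≡x-z-y x w z)))

  ⋆-identityˡ : ∀ f → δ ε ⋆ f ≗ f
  ⋆-identityˡ f x = trans (sum-δ-* ε (λ y → f (x - y))) (cong f (x-ε≡x x))

  ⋆-identityʳ : ∀ f → f ⋆ δ ε ≗ f
  ⋆-identityʳ f x = trans (⋆-comm f (δ ε) x) (⋆-identityˡ f x)

  ⋆-distribʳ : ∀ h f g → (f ⊞ g) ⋆ h ≗ (f ⋆ h) ⊞ (g ⋆ h)
  ⋆-distribʳ h f g x = trans (sum-cong-≗ (λ y → *-distribʳ-+ (h (x - y)) (f y) (g y)))
    (∑-distrib-+ (λ y → f y * h (x - y)) (λ y → g y * h (x - y)))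

  ⋆-zeroˡ : ∀ f → const 0 ⋆ f ≗ const 0
  ⋆-zeroˡ f x = sum-replicate-zero n

  ⋆-congʳ : ∀ h {f f′} → f ≗ f′ → f ⋆ h ≗ f′ ⋆ h
  ⋆-congʳ h f≗f′ x = sum-cong-≗ (λ y → cong (_* h (x - y)) (f≗f′ y))

  ⋆-congˡ : ∀ f {h h′} → h ≗ h′ → f ⋆ h ≗ f ⋆ h′
  ⋆-congˡ f h≗h′ x = sum-cong-≗ (λ y → cong (f y *_) (h≗h′ (x - y)))

  ⋆-cong : ∀ {f f′ g g′} → f ≗ f′ → g ≗ g′ → f ⋆ g ≗ f′ ⋆ g′
  ⋆-cong {f′ = f′} {g} f≗f′ g≗g′ x = trans (⋆-congʳ g f≗f′ x) (⋆-congˡ f′ g≗g′ x)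

  convolutionSemiring : CommutativeSemiring 0ℓ 0ℓ
  convolutionSemiring = record
    { Carrier = Fin n → ℕ
    ; _≈_ = _≗_
    ; _+_ = _⊞_
    ; _*_ = _⋆_
    ; 0# = const 0
    ; 1# = δ ε
    ; isCommutativeSemiring = isCommutativeSemiringˡ record
      { +-isCommutativeMonoid = Pointwise.isCommutativeMonoid (Fin n) +-0-isCommutativeMonoid
      ; *-isCommutativeMonoid = record
        { isMonoid = record
          { isSemigroup = record
            { isMagma = record
              { isEquivalence = Pointwise.isEquivalence (Fin n) isEquivalence
              ; ∙-cong = ⋆-cong
              }
            ; assoc = ⋆-assoc
            }
          ; identity = ⋆-identityˡ , ⋆-identityʳ
          }
        ; comm = ⋆-comm
        }
      ; distribʳ = ⋆-distribʳ
      ; zeroˡ = ⋆-zeroˡ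
      }
    }

  open CommutativeSemiring convolutionSemiring using (semiring)
  open import Algebra.Properties.Semiring.Exp semiring using (^-congˡ) renaming (_^_ to _⋆^_)
  open import Algebra.Properties.Semiring.Sum semiring using () renaming (sum to sumᶠ)
  open import Algebra.Properties.Semiring.Mult semiring using () renaming (_×_ to _×ᶠ_)
  open import Algebra.Properties.CommutativeSemiring.Binomial convolutionSemiring
    using (theorem; binomial)

  sumᶠ-apply : ∀ {m} (F : Fin m → Fin n → ℕ) x → sumᶠ F x ≡ sum (λ i → F i x)
  sumᶠ-apply {zero}  F x = refl
  sumᶠ-apply {suc m} F x = cong (F zero x +_) (sumᶠ-apply (F ∘ suc) x)

  ×ᶠ-apply : ∀ c f x → (c ×ᶠ f) x ≡ c * f x
  ×ᶠ-apply zero    f x = refl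
  ×ᶠ-apply (suc c) f x = cong (f x +_) (×ᶠ-apply c f x)

  sum-⋆ : ∀ f g → sum (f ⋆ g) ≡ sum f * sum g
  sum-⋆ f g = begin
    sum (λ x → sum (λ y → f y * g (x - y)))
      ≡⟨ ∑-comm (λ x y → f y * g (x - y)) ⟩
    sum (λ y → sum (λ x → f y * g (x - y)))
      ≡⟨ sum-cong-≗ (λ y → *-distribˡ-sum (f y) (λ x → g (x - y))) ⟨
    sum (λ y → f y * sum (λ x → g (x - y)))
      ≡⟨ sum-cong-≗ (λ y → cong (f y *_) (sum-translate g y)) ⟩
    sum (λ y → f y * sum g)
      ≡⟨ *-distribʳ-sum (sum g) f ⟨
    sum f * sum g
      ∎
    where open ≡-Reasoning

  sum-⋆^ : ∀ f j → sum (f ⋆^ j) ≡ sum f ^ j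
  sum-⋆^ f zero    = sum-δ ε
  sum-⋆^ f (suc j) = trans (sum-⋆ f (f ⋆^ j)) (cong (sum f *_) (sum-⋆^ f j))

  ⋆-const : ∀ f c → f ⋆ const c ≗ const (sum f * c)
  ⋆-const f c x = sym (*-distribʳ-sum c f)

  δ⋆δ : ∀ a b → δ a ⋆ δ b ≗ δ (a ∙ b)
  δ⋆δ a b x = begin
    sum (λ y → δ a y * δ b (x - y))  ≡⟨ sum-δ-* a (λ y → δ b (x - y)) ⟩
    δ b (x - a)                      ≡⟨ δ-injective (λ {i} {j} → ∙-cancelʳ a i j) b (x - a) ⟨
    δ (b ∙ a) ((x - a) ∙ a)          ≡⟨ cong₂ δ (comm b a) (//-rightDividesˡ a x) ⟩
    δ (a ∙ b) x                      ∎
    where open ≡-Reasoning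

  δ⋆^ : ∀ a j → δ a ⋆^ j ≗ δ (j · a)
  δ⋆^ a zero    x = refl
  δ⋆^ a (suc j) x = trans (⋆-congˡ (δ a) (δ⋆^ a j) x) (δ⋆δ a (j · a) x)

  push-1· : ∀ f → push (1 ·_) f ≗ f
  push-1· f x = trans (push-congʳ f ×-homo-1 x) (push-id f x)

  push-·-push-· : ∀ i j f → push (i ·_) (push (j ·_) f) ≗ push ((i * j) ·_) f
  push-·-push-· i j f x = trans (push-∘ (i ·_) (j ·_) f x) (push-congʳ f (λ y → ×-assocˡ y i j) x)

  δ⊞-⋆^-%-prime : ∀ {p} .{{_ : NonZero p}} → Prime p → ∀ a g x →
                  ((δ a ⊞ g) ⋆^ p) x % p ≡ ((g ⋆^ p) x + δ (p · a) x) % p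
  δ⊞-⋆^-%-prime {p} pr a g x = begin
    ((δ a ⊞ g) ⋆^ p) x % p               ≡⟨ cong (_% p) expand ⟩
    sum (λ k → (p C toℕ k) * b k x) % p  ≡⟨ binomial-sum-%-prime pr (λ k → b k x) ⟩
    (b zero x + b (fromℕ p) x) % p       ≡⟨ cong₂ (λ u v → (u + v) % p) (⋆-identityˡ (g ⋆^ p) x) bₚ≡δ ⟩
    ((g ⋆^ p) x + δ (p · a) x) % p       ∎
    where
    open ≡-Reasoning
    b = binomial (δ a) g p
    expand : ((δ a ⊞ g) ⋆^ p) x ≡ sum (λ k → (p C toℕ k) * b k x)
    expand = trans (theorem p (δ a) g x)
      (trans (sumᶠ-apply (λ k → (p C toℕ k) ×ᶠ b k) x) (sum-cong-≗ (λ k → ×ᶠ-apply (p C toℕ k) (b k) x)))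
    bₚ≡δ : b (fromℕ p) x ≡ δ (p · a) x
    bₚ≡δ = begin
      ((δ a ⋆^ toℕ (fromℕ p)) ⋆ (g ⋆^ (p ∸ toℕ (fromℕ p)))) x
        ≡⟨ cong (λ k → ((δ a ⋆^ k) ⋆ (g ⋆^ (p ∸ k))) x) (toℕ-fromℕ p) ⟩
      ((δ a ⋆^ p) ⋆ (g ⋆^ (p ∸ p))) x
        ≡⟨ cong (λ k → ((δ a ⋆^ p) ⋆ (g ⋆^ k)) x) (n∸n≡0 p) ⟩
      ((δ a ⋆^ p) ⋆ δ ε) x
        ≡⟨ ⋆-identityʳ (δ a ⋆^ p) x ⟩
      (δ a ⋆^ p) x
        ≡⟨ δ⋆^ a p x ⟩
      δ (p · a) x
        ∎

  frobenius : ∀ {p} .{{_ : NonZero p}} → Prime p → ∀ f x → (f ⋆^ p) x % p ≡ push (p ·_) f x % p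
  frobenius {p} pr f = by-mass (sum f) f refl
    where
    open ≡-Reasoning
    0^k≡0 : ∀ {k} .{{_ : NonZero k}} → 0 ^ k ≡ 0
    0^k≡0 {suc _} = refl

    by-mass : ∀ M f → sum f ≡ M → ∀ x → (f ⋆^ p) x % p ≡ push (p ·_) f x % p
    by-mass zero f sum≡0 x = cong (_% p) (trans
      (sum≡0⇒≗0 (f ⋆^ p) (trans (sum-⋆^ f p) (trans (cong (_^ p) sum≡0) 0^k≡0)) x)
      (sym (sum≡0⇒≗0 (push (p ·_) f) (trans (sum-push (p ·_) f) sum≡0) x)))
    by-mass (suc M) f sum≡ x with sum≢0⇒∃≢0 f (λ sum≡0 → 0≢1+n (trans (sym sum≡0) sum≡))
    ... | y , fy≢0 = begin
      (f ⋆^ p) x % p                       ≡⟨ cong (_% p) (^-congˡ p f≗δ⊞g x) ⟩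
      ((δ y ⊞ g) ⋆^ p) x % p               ≡⟨ δ⊞-⋆^-%-prime pr y g x ⟩
      ((g ⋆^ p) x + δ (p · y) x) % p       ≡⟨ %-+-congˡ (δ (p · y) x) (by-mass M g sum-g x) ⟩
      (push (p ·_) g x + δ (p · y) x) % p  ≡⟨ cong (_% p) push-split ⟨
      push (p ·_) f x % p                  ∎
      where
      g = λ z → f z ∸ δ y z
      f≗δ⊞g : f ≗ δ y ⊞ g
      f≗δ⊞g = δ-split f y fy≢0
      sum-g : sum g ≡ M
      sum-g = suc-injective (begin
        suc (sum g)        ≡⟨ cong (_+ sum g) (sum-δ y) ⟨
        sum (δ y) + sum g  ≡⟨ ∑-distrib-+ (δ y) g ⟨
        sum (δ y ⊞ g)      ≡⟨ sum-cong-≗ f≗δ⊞g ⟨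
        sum f              ≡⟨ sum≡ ⟩
        suc M              ∎)
      push-split : push (p ·_) f x ≡ push (p ·_) g x + δ (p · y) x
      push-split = begin
        push (p ·_) f x                        ≡⟨ push-congˡ (p ·_) f≗δ⊞g x ⟩
        push (p ·_) (δ y ⊞ g) x                ≡⟨ push-⊞ (p ·_) (δ y) g x ⟩
        push (p ·_) (δ y) x + push (p ·_) g x  ≡⟨ cong (_+ push (p ·_) g x) (push-δ (p ·_) y x) ⟩
        δ (p · y) x + push (p ·_) g x          ≡⟨ +-comm (δ (p · y) x) _ ⟩
        push (p ·_) g x + δ (p · y) x          ∎

  IsTiling : (Fin n → ℕ) → (Fin n → ℕ) → Set
  IsTiling f h = f ⋆ h ≗ const 1

  IsTiling-congˡ : ∀ {f f′} h → f ≗ f′ → IsTiling f h → IsTiling f′ h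
  IsTiling-congˡ h f≗f′ tiling x = trans (sym (⋆-congʳ h f≗f′ x)) (tiling x)

  tiling⇒≤1 : ∀ f h → IsTiling f h → ∀ y → f y ≤ 1
  tiling⇒≤1 f h tiling y
    with sum≢0⇒∃≢0 (λ z → f z * h (y - z)) (λ sum≡0 → 1+n≢0 (trans (sym (tiling y)) sum≡0))
  ... | z , term≢0 = begin
    f y                     ≤⟨ m≤m*n (f y) (h t) ⟩
    f y * h t               ≡⟨ cong (λ w → f y * h w) y∙t-y≡t ⟨
    f y * h ((y ∙ t) - y)   ≤⟨ term≤sum (λ w → f w * h ((y ∙ t) - w)) y ⟩
    (f ⋆ h) (y ∙ t)         ≡⟨ tiling (y ∙ t) ⟩
    1                       ∎
    where
    open ≤-Reasoning
    t = y - z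
    instance _ = ≢-nonZero (*≢0⇒≢0ʳ (f z) (h t) term≢0)
    y∙t-y≡t : (y ∙ t) - y ≡ t
    y∙t-y≡t = trans (cong (_- y) (comm y t)) (//-rightDividesʳ y t)

  push-prime-preserves-tiling : ∀ {p} f h → Prime p → ¬ p ∣ sum f →
                                IsTiling f h → IsTiling (push (p ·_) f) h
  push-prime-preserves-tiling {p} f h pr p∤∑f tiling x = sym (≤∧sum≡⇒≗ {f = const 1} 1≤F ∑1≡∑F x)
    where
    open ≡-Reasoning
    instance _ = prime⇒nonZero pr
    F = push (p ·_) f ⋆ h
    f^k⋆h : ∀ {k} .{{_ : NonZero k}} x → ((f ⋆^ k) ⋆ h) x ≡ sum f ^ pred k
    f^k⋆h {suc k} x = begin
      ((f ⋆ f ⋆^ k) ⋆ h) x  ≡⟨ ⋆-congʳ h (⋆-comm f (f ⋆^ k)) x ⟩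
      ((f ⋆^ k ⋆ f) ⋆ h) x  ≡⟨ ⋆-assoc (f ⋆^ k) f h x ⟩
      (f ⋆^ k ⋆ (f ⋆ h)) x  ≡⟨ ⋆-congˡ (f ⋆^ k) tiling x ⟩
      (f ⋆^ k ⋆ const 1) x  ≡⟨ ⋆-const (f ⋆^ k) 1 x ⟩
      sum (f ⋆^ k) * 1      ≡⟨ *-identityʳ _ ⟩
      sum (f ⋆^ k)          ≡⟨ sum-⋆^ f k ⟩
      sum f ^ k             ∎
    F%p : ∀ x → F x % p ≡ sum f ^ pred p % p
    F%p x = begin
      F x % p
        ≡⟨ %-sum-cong (λ y → push (p ·_) f y * h (x - y)) (λ y → (f ⋆^ p) y * h (x - y))
             (λ y → %-*-congʳ {a = push (p ·_) f y} (h (x - y)) (sym (frobenius pr f y))) ⟩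
      ((f ⋆^ p) ⋆ h) x % p
        ≡⟨ cong (_% p) (f^k⋆h x) ⟩
      sum f ^ pred p % p
        ∎
    1≤F : ∀ x → 1 ≤ F x
    1≤F x = n≢0⇒n>0 (λ Fx≡0 → prime∤^ pr p∤∑f (pred p) (m%n≡0⇒n∣m (sum f ^ pred p) p (begin
      sum f ^ pred p % p  ≡⟨ F%p x ⟨
      F x % p             ≡⟨ cong (_% p) Fx≡0 ⟩
      0 % p               ≡⟨ m<n⇒m%n≡m (>-nonZero⁻¹ p) ⟩
      0                   ∎)))
    ∑1≡∑F : sum {n} (const 1) ≡ sum F
    ∑1≡∑F = begin
      sum {n} (const 1)            ≡⟨ sum-cong-≗ tiling ⟨
      sum (f ⋆ h)                  ≡⟨ sum-⋆ f h ⟩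
      sum f * sum h                ≡⟨ cong (_* sum h) (sum-push (p ·_) f) ⟨
      sum (push (p ·_) f) * sum h  ≡⟨ sum-⋆ (push (p ·_) f) h ⟨
      sum F                        ∎

  push-product-preserves-tiling : ∀ f h ps → All Prime ps → Coprime (product ps) (sum f) →
                                  IsTiling f h → IsTiling (push (product ps ·_) f) h
  push-product-preserves-tiling f h [] [] _ = IsTiling-congˡ h (λ x → sym (push-1· f x))
  push-product-preserves-tiling f h (p ∷ ps) (pr ∷ prs) coprime tiling =
    IsTiling-congˡ h (push-·-push-· p (product ps) f)
      (push-prime-preserves-tiling (push (product ps ·_) f) h pr p∤∑f′
        (push-product-preserves-tiling f h ps prs (coprime-∣ (n∣m*n p) coprime) tiling))
    where
    p∤∑f′ : ¬ p ∣ sum (push (product ps ·_) f)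
    p∤∑f′ = subst (¬_ ∘ (p ∣_)) (sym (sum-push (product ps ·_) f))
      (prime∧coprime⇒∤ pr (coprime-∣ (m∣m*n (product ps)) coprime))

  push-coprime-preserves-tiling : ∀ {j} .{{_ : NonZero j}} f h → Coprime j (sum f) →
                                  IsTiling f h → IsTiling (push (j ·_) f) h
  push-coprime-preserves-tiling {j} f h coprime tiling =
    subst (λ k → IsTiling (push (k ·_) f) h) (sym j≡∏ps)
      (push-product-preserves-tiling f h (factors j-factorisation)
        (PrimeFactorisation.factorsPrime j-factorisation)
        (subst (λ k → Coprime k (sum f)) j≡∏ps coprime) tiling)
    where
    j-factorisation = factorise j
    j≡∏ps = PrimeFactorisation.isFactorisation j-factorisation

module Cyclic (k : ℕ) where

  private
    N = suc k

  neg : Fin N → Fin N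
  neg a = (N ∸ toℕ a) mod N

  toℕ-mod : ∀ x → toℕ (x mod N) ≡ x % N
  toℕ-mod x = toℕ-fromℕ< _

  toℕ-⊕ : ∀ a b → toℕ (a ⊕ b) ≡ (toℕ a + toℕ b) % N
  toℕ-⊕ a b = toℕ-mod (toℕ a + toℕ b)

  ⊕-comm : ∀ a b → a ⊕ b ≡ b ⊕ a
  ⊕-comm a b = toℕ-injective (begin
    toℕ (a ⊕ b)          ≡⟨ toℕ-⊕ a b ⟩
    (toℕ a + toℕ b) % N  ≡⟨ cong (_% N) (+-comm (toℕ a) (toℕ b)) ⟩
    (toℕ b + toℕ a) % N  ≡⟨ toℕ-⊕ b a ⟨
    toℕ (b ⊕ a)          ∎)
    where open ≡-Reasoning

  ⊕-assoc : ∀ a b c → (a ⊕ b) ⊕ c ≡ a ⊕ (b ⊕ c)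
  ⊕-assoc a b c = toℕ-injective (begin
    toℕ ((a ⊕ b) ⊕ c)                  ≡⟨ toℕ-⊕ (a ⊕ b) c ⟩
    (toℕ (a ⊕ b) + toℕ c) % N          ≡⟨ cong (λ x → (x + toℕ c) % N) (toℕ-⊕ a b) ⟩
    ((toℕ a + toℕ b) % N + toℕ c) % N  ≡⟨ [m%d+n]%d≡[m+n]%d (toℕ a + toℕ b) (toℕ c) N ⟩
    (toℕ a + toℕ b + toℕ c) % N        ≡⟨ cong (_% N) (+-assoc (toℕ a) (toℕ b) (toℕ c)) ⟩
    (toℕ a + (toℕ b + toℕ c)) % N      ≡⟨ [m+n%d]%d≡[m+n]%d (toℕ a) (toℕ b + toℕ c) N ⟨
    (toℕ a + (toℕ b + toℕ c) % N) % N  ≡⟨ cong (λ x → (toℕ a + x) % N) (toℕ-⊕ b c) ⟨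
    (toℕ a + toℕ (b ⊕ c)) % N          ≡⟨ toℕ-⊕ a (b ⊕ c) ⟨
    toℕ (a ⊕ (b ⊕ c))                  ∎)
    where open ≡-Reasoning

  ⊕-identityˡ : ∀ a → zero ⊕ a ≡ a
  ⊕-identityˡ a = toℕ-injective (trans (toℕ-⊕ zero a) (m<n⇒m%n≡m (toℕ<n a)))

  ⊕-inverseˡ : ∀ a → neg a ⊕ a ≡ zero
  ⊕-inverseˡ a = toℕ-injective (begin
    toℕ (neg a ⊕ a)                ≡⟨ toℕ-⊕ (neg a) a ⟩
    (toℕ (neg a) + toℕ a) % N      ≡⟨ cong (λ x → (x + toℕ a) % N) (toℕ-mod (N ∸ toℕ a)) ⟩
    ((N ∸ toℕ a) % N + toℕ a) % N  ≡⟨ [m%d+n]%d≡[m+n]%d (N ∸ toℕ a) (toℕ a) N ⟩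
    (N ∸ toℕ a + toℕ a) % N        ≡⟨ cong (_% N) (m∸n+n≡m (<⇒≤ (toℕ<n a))) ⟩
    N % N                          ≡⟨ n%n≡0 N ⟩
    0                              ∎)
    where open ≡-Reasoning

  isAbelianGroup : IsAbelianGroup _≡_ _⊕_ zero neg
  isAbelianGroup = record
    { isGroup = record
      { isMonoid = record
        { isSemigroup = record
          { isMagma = record { isEquivalence = isEquivalence ; ∙-cong = cong₂ _⊕_ }
          ; assoc = ⊕-assoc
          }
        ; identity = ⊕-identityˡ , (λ a → trans (⊕-comm a zero) (⊕-identityˡ a))
        }
      ; inverse = ⊕-inverseˡ , (λ a → trans (⊕-comm a (neg a)) (⊕-inverseˡ a))
      ; ⁻¹-cong = cong neg
      }
    ; comm = ⊕-comm
    }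

  abelianGroup : AbelianGroup 0ℓ 0ℓ
  abelianGroup = record { isAbelianGroup = isAbelianGroup }

  open AbelianGroup abelianGroup using (monoid)
  open import Algebra.Properties.Monoid.Mult monoid public using () renaming (_×_ to _·_)

  toℕ-· : ∀ j y → toℕ (j · y) ≡ (j * toℕ y) % N
  toℕ-· zero    y = refl
  toℕ-· (suc j) y = begin
    toℕ (y ⊕ (j · y))              ≡⟨ toℕ-⊕ y (j · y) ⟩
    (toℕ y + toℕ (j · y)) % N      ≡⟨ cong (λ x → (toℕ y + x) % N) (toℕ-· j y) ⟩
    (toℕ y + (j * toℕ y) % N) % N  ≡⟨ [m+n%d]%d≡[m+n]%d (toℕ y) (j * toℕ y) N ⟩
    (toℕ y + j * toℕ y) % N        ∎
    where open ≡-Reasoning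

module TotalPerfectCodes (k a m : ℕ) (N≡a*m : suc k ≡ a * m) where

  open Cyclic k
  open Convolution isAbelianGroup
    using (_⋆_; ⋆-∘⁻¹; IsTiling; tiling⇒≤1; push-coprime-preserves-tiling)
  open import Algebra.Properties.AbelianGroup abelianGroup using (//-rightDividesˡ; ∙-cancelˡ)
  open Equivalence using (to; from)

  private
    N = suc k
    instance
      a*m≢0 : NonZero (a * m)
      a*m≢0 = subst NonZero N≡a*m _
      a≢0 : NonZero a
      a≢0 = m*n≢0⇒m≢0 a
      m≢0 : NonZero m
      m≢0 = m*n≢0⇒n≢0 a

  DistinctResidues : Subset N → Set
  DistinctResidues S = (s s′ : Fin N) → s ∈ S → s′ ∈ S → s ≢ s′ → ¬ (toℕ s ≡ toℕ s′ [mod a ])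

  residue : Fin N → Fin a
  residue x = toℕ x mod a

  toℕ-residue : ∀ x → toℕ (residue x) ≡ toℕ x % a
  toℕ-residue x = toℕ-fromℕ< _

  residue≡⇔≡[mod] : ∀ x y → residue x ≡ residue y ⇔ (toℕ x ≡ toℕ y [mod a ])
  residue≡⇔≡[mod] x y = mk⇔
    (λ eq → %≡%⇒≡[mod] (toℕ x) (toℕ y)
      (trans (sym (toℕ-residue x)) (trans (cong toℕ eq) (toℕ-residue y))))
    (λ x≡y → toℕ-injective
      (trans (toℕ-residue x) (trans (≡[mod]⇒%≡% (toℕ x) (toℕ y) x≡y) (sym (toℕ-residue y)))))

  toℕ-residue-⊕ : ∀ v c → toℕ (residue (v ⊕ c)) ≡ (toℕ v + toℕ c) % a
  toℕ-residue-⊕ v c = begin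
    toℕ (residue (v ⊕ c))    ≡⟨ toℕ-residue (v ⊕ c) ⟩
    toℕ (v ⊕ c) % a          ≡⟨ cong (_% a) (toℕ-⊕ v c) ⟩
    (toℕ v + toℕ c) % N % a  ≡⟨ m∣n⇒o%n%m≡o%m a N (toℕ v + toℕ c) (divides m (trans N≡a*m (*-comm a m))) ⟩
    (toℕ v + toℕ c) % a      ∎
    where open ≡-Reasoning

  residue-⊕≡residue⇔∣ : ∀ v c → residue (v ⊕ c) ≡ residue v ⇔ a ∣ toℕ c
  residue-⊕≡residue⇔∣ v c = mk⇔
    (λ eq → subst (a ∣_) ∣v+c-v∣≡c (%≡%⇒≡[mod] (toℕ v + toℕ c) (toℕ v)
      (trans (sym (toℕ-residue-⊕ v c)) (trans (cong toℕ eq) (toℕ-residue v)))))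
    (λ a∣c → toℕ-injective
      (trans (toℕ-residue-⊕ v c) (trans (%-remove-+ʳ (toℕ v) a∣c) (sym (toℕ-residue v)))))
    where
    ∣v+c-v∣≡c : ∣ toℕ v + toℕ c - toℕ v ∣ ≡ toℕ c
    ∣v+c-v∣≡c = trans (∣-∣-comm (toℕ v + toℕ c) (toℕ v)) (∣m-m+n∣≡n (toℕ v) (toℕ c))

  toℕ-m· : ∀ y → toℕ (m · y) ≡ toℕ y % a * m
  toℕ-m· y = begin
    toℕ (m · y)            ≡⟨ toℕ-· m y ⟩
    (m * toℕ y) % N        ≡⟨ cong (_% N) (*-comm m (toℕ y)) ⟩
    (toℕ y * m) % N        ≡⟨ %-congʳ N≡a*m ⟩
    (toℕ y * m) % (a * m)  ≡⟨ m%n*o≡m*o%[n*o] (toℕ y) a m ⟨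
    toℕ y % a * m          ∎
    where open ≡-Reasoning

  residue≡⇒m·≡ : ∀ x y → residue x ≡ residue y → m · x ≡ m · y
  residue≡⇒m·≡ x y eq = toℕ-injective (begin
    toℕ (m · x)    ≡⟨ toℕ-m· x ⟩
    toℕ x % a * m  ≡⟨ cong (_* m) (trans (sym (toℕ-residue x)) (trans (cong toℕ eq) (toℕ-residue y))) ⟩
    toℕ y % a * m  ≡⟨ toℕ-m· y ⟨
    toℕ (m · y)    ∎)
    where open ≡-Reasoning

  totalPerfectCode⇒tiling : ∀ {S code} → SquareFree S → IsTotalPerfectCode S code →
                            IsTiling 𝟙[ S ] (𝟙[ code ] ∘ neg)
  totalPerfectCode⇒tiling {S} {code} square-free tpc v with tpc v
  ... | c₀ , (c₀∈code , _ , v⊕c₀∈S) , unique = begin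
    (𝟙[ S ] ⋆ (𝟙[ code ] ∘ neg)) v            ≡⟨ ⋆-∘⁻¹ 𝟙[ S ] 𝟙[ code ] v ⟩
    sum (λ c → 𝟙[ S ] (c ⊕ v) * 𝟙[ code ] c)  ≡⟨ sum-single _ c₀ others≡0 ⟩
    𝟙[ S ] (c₀ ⊕ v) * 𝟙[ code ] c₀            ≡⟨ cong₂ _*_ (∈⇒𝟙[]≡1 c₀⊕v∈S) (∈⇒𝟙[]≡1 c₀∈code) ⟩
    1                                         ∎
    where
    open ≡-Reasoning
    c₀⊕v∈S = subst (_∈ S) (⊕-comm v c₀) v⊕c₀∈S
    others≡0 : ∀ c → c ≢ c₀ → 𝟙[ S ] (c ⊕ v) * 𝟙[ code ] c ≡ 0
    others≡0 c c≢c₀ = 𝟙[]*𝟙[]≡0 S code (c ⊕ v) c λ (c⊕v∈S , c∈code) →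
      let v⊕c∈S = subst (_∈ S) (⊕-comm c v) c⊕v∈S
          v≢c   = λ v≡c → square-free (v , subst (λ z → (v ⊕ z) ∈ S) (sym v≡c) v⊕c∈S)
      in c≢c₀ (sym (unique (c∈code , v≢c , v⊕c∈S)))

  totalPerfectCode⇒distinctResidues : ∀ {S} → SquareFree S → ∣ S ∣ ≡ a → Coprime a m →
                                      HasTotalPerfectCode S → DistinctResidues S
  totalPerfectCode⇒distinctResidues {S} square-free |S|≡a coprime (code , tpc) s s′ s∈S s′∈S s≢s′ s≡s′ =
    contradiction 2≤1 λ { (s≤s ()) }
    where
    open ≤-Reasoning
    F = push (m ·_) 𝟙[ S ]
    tiling : IsTiling F (𝟙[ code ] ∘ neg)
    tiling = push-coprime-preserves-tiling 𝟙[ S ] (𝟙[ code ] ∘ neg)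
      (subst (Coprime m) (sym (trans (sum-𝟙[] S) |S|≡a)) (Coprimality.sym coprime))
      (totalPerfectCode⇒tiling square-free tpc)
    m·s≡m·s′ : m · s ≡ m · s′
    m·s≡m·s′ = residue≡⇒m·≡ s s′ (from (residue≡⇔≡[mod] s s′) s≡s′)
    2≤1 : 2 ≤ 1
    2≤1 = begin
      2                     ≡⟨ cong₂ _+_ (∈⇒𝟙[]≡1 s∈S) (∈⇒𝟙[]≡1 s′∈S) ⟨
      𝟙[ S ] s + 𝟙[ S ] s′  ≤⟨ push-collision (m ·_) 𝟙[ S ] s≢s′ m·s≡m·s′ ⟩
      F (m · s)             ≤⟨ tiling⇒≤1 F (𝟙[ code ] ∘ neg) tiling (m · s) ⟩
      1                     ∎

  aℤ : Subset N
  aℤ = tabulate (λ c → does (a ∣? toℕ c))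

  ∈aℤ⇔∣ : ∀ c → c ∈ aℤ ⇔ a ∣ toℕ c
  ∈aℤ⇔∣ c = mk⇔
    (λ c∈aℤ → decidable-stable (a ∣? toℕ c) (λ a∤c → true≢false (begin
      true               ≡⟨ []=⇒lookup c∈aℤ ⟨
      lookup aℤ c        ≡⟨ lookup∘tabulate (λ c → does (a ∣? toℕ c)) c ⟩
      does (a ∣? toℕ c)  ≡⟨ dec-false (a ∣? toℕ c) a∤c ⟩
      false              ∎)))
    (λ a∣c → lookup⇒[]= c aℤ
      (trans (lookup∘tabulate (λ c → does (a ∣? toℕ c)) c) (dec-true (a ∣? toℕ c) a∣c)))
    where
    open ≡-Reasoning
    true≢false : true ≢ false
    true≢false ()

  distinctResidues⇒residue-injective : ∀ {S} → DistinctResidues S → ∀ {s s′} → s ∈ S → s′ ∈ S →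
                                       residue s ≡ residue s′ → s ≡ s′
  distinctResidues⇒residue-injective distinct {s} {s′} s∈S s′∈S eq = decidable-stable (s ≟ s′)
    (λ s≢s′ → distinct s s′ s∈S s′∈S s≢s′ (to (residue≡⇔≡[mod] s s′) eq))

  residue-surjective : ∀ {S} → ∣ S ∣ ≡ a → DistinctResidues S →
                       ∀ ρ → ∃ λ s → s ∈ S × residue s ≡ ρ
  residue-surjective {S} |S|≡a distinct ρ
    with push≢0⇒∃ residue 𝟙[ S ] (λ Rρ≡0 → 1+n≢0 (trans (sym (R≗1 ρ)) Rρ≡0))
    where
    R≗1 : push residue 𝟙[ S ] ≗ const 1
    R≗1 = ≤∧sum≡⇒≗ {g = const 1} (push≤1 residue 𝟙[ S ] (𝟙[]≤1 S) injective) (begin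
      sum (push residue 𝟙[ S ])  ≡⟨ sum-push residue 𝟙[ S ] ⟩
      sum 𝟙[ S ]                 ≡⟨ trans (sum-𝟙[] S) |S|≡a ⟩
      a                          ≡⟨ sum-const-1 a ⟨
      sum {a} (const 1)          ∎)
      where
      open ≡-Reasoning
      injective : ∀ s s′ → 𝟙[ S ] s ≢ 0 → 𝟙[ S ] s′ ≢ 0 → residue s ≡ residue s′ → s ≡ s′
      injective s s′ 𝟙s≢0 𝟙s′≢0 =
        distinctResidues⇒residue-injective distinct (𝟙[]≢0⇒∈ S s 𝟙s≢0) (𝟙[]≢0⇒∈ S s′ 𝟙s′≢0)
  ... | s , 𝟙s≢0 , residue-s≡ρ = s , 𝟙[]≢0⇒∈ S s 𝟙s≢0 , residue-s≡ρ

  distinctResidues⇒totalPerfectCode : ∀ {S} → SquareFree S → ∣ S ∣ ≡ a → DistinctResidues S →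
                                      IsTotalPerfectCode S aℤ
  distinctResidues⇒totalPerfectCode {S} square-free |S|≡a distinct v
    with residue-surjective |S|≡a distinct (residue v)
  ... | s , s∈S , residue-s≡residue-v = c , (c∈aℤ , v≢c , v⊕c∈S) , unique
    where
    c = s ⊕ neg v
    v⊕c≡s : v ⊕ c ≡ s
    v⊕c≡s = trans (⊕-comm v c) (//-rightDividesˡ v s)
    v⊕c∈S : (v ⊕ c) ∈ S
    v⊕c∈S = subst (_∈ S) (sym v⊕c≡s) s∈S
    c∈aℤ : c ∈ aℤ
    c∈aℤ = from (∈aℤ⇔∣ c) (to (residue-⊕≡residue⇔∣ v c) (trans (cong residue v⊕c≡s) residue-s≡residue-v))
    v≢c : v ≢ c
    v≢c v≡c = square-free (v , subst (λ z → (v ⊕ z) ∈ S) (sym v≡c) v⊕c∈S)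
    unique : ∀ {c′} → c′ ∈ aℤ × CSAdj S v c′ → c ≡ c′
    unique {c′} (c′∈aℤ , _ , v⊕c′∈S) = ∙-cancelˡ v c c′ (trans v⊕c≡s
      (distinctResidues⇒residue-injective distinct s∈S v⊕c′∈S (trans residue-s≡residue-v
        (sym (from (residue-⊕≡residue⇔∣ v c′) (to (∈aℤ⇔∣ c′) c′∈aℤ))))))

theorem3p8 : (n p q m : ℕ) → 6 ≤ n → Prime p → Prime q →
    n ≡ (p * q) * m → Coprime (p * q) m →
    (S : Subset n) → SquareFree S → Periodic S → ∣ S ∣ ≡ p * q →
    Connected S →
    HasTotalPerfectCode S ⇔
      ((s s′ : Fin n) → s ∈ S → s′ ∈ S → s ≢ s′ →
        ¬ (toℕ s ≡ toℕ s′ [mod (p * q) ]))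
theorem3p8 zero _ _ _ ()
theorem3p8 (suc k) p q m _ _ _ n≡pqm coprime S square-free _ |S|≡pq _ =
  mk⇔ (totalPerfectCode⇒distinctResidues square-free |S|≡pq coprime)
      (λ distinct → aℤ , distinctResidues⇒totalPerfectCode square-free |S|≡pq distinct)
  where open TotalPerfectCodes k (p * q) m n≡pqm
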